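{- Let $(\mathscr A,\preceq,\multimap)$ be an implicative structure and $S$ a linear separator. For all $a,a',b,b'\in\mathscr A$, if $a\dashv\vdash_S a'$ and $b\dashv\vdash_S b'$, then $(a\multimap b)\dashv\vdash_S(a'\multimap b')$ and $(a\otimes b)\dashv\vdash_S(a'\otimes b')$. Consequently the operations $[a]\multimap[b]:=[a\multimap b]$ and $[a]\otimes[b]:=[a\otimes b]$ are well defined on the quotient $\mathscr A/\dashv\vdash_S$.
   Context: An implicative structure is a complete lattice $(\mathscr A,\preceq)$ with binary $\multimap$ (right-associative) such that $a'\preceq a$, $b\preceq b'$ imply $(a\multimap b)\preceq(a'\multimap b')$, and $a\multimap\bigwedge_{b\in B}b=\bigwedge_{b\in B}(a\multimap b)$. Set $a\otimes b:=\bigwedge_{c}((a\multimap b\multimap c)\multimap c)$. A linear separator is a subset $S$ that is upward closed, closed under modus ponens ($a\in S$, $(a\multimap b)\in S$ imply $b\in S$), and contains $\bigwedge_a(a\multimap a)$, $\bigwedge_{a,b,c}((b\multimap c)\multimap(a\multimap b)\multimap a\multimap c)$, $\bigwedge_{a,b,c}((a\multimap b\multimap c)\multimap b\multimap a\multimap c)$. Entailment: $a\vdash_S b$ iff $(a\multimap b)\in S$; this is a preorder, and $a\dashv\vdash_S b$ means $a\vdash_S b$ and $b\vdash_S a$; $[a]$ denotes the equivalence class of $a$. -}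

module Defs where

open import Level using (suc; zero)
open import Data.Product using (_×_; _,_; Σ)
open import Relation.Binary.PropositionalEquality using (_≡_)

-- An implicative structure: a complete lattice (A, ≼) (arbitrary meets of
-- families indexed by a type I : Set; subsets B ⊆ A are the families
-- Σ A B → A) with a binary implication ⊸ anti/monotone and commuting
-- with arbitrary meets in its second argument.
record ImplicativeStructure : Set₁ where
  infixr 20 _⊸_
  infix 4 _≼_
  field
    Carrier   : Set
    _≼_       : Carrier → Carrier → Set
    ≼-refl    : ∀ {a} → a ≼ a
    ≼-trans   : ∀ {a b c} → a ≼ b → b ≼ c → a ≼ c
    ≼-antisym : ∀ {a b} → a ≼ b → b ≼ a → a ≡ b
    ⋀         : {I : Set} → (I → Carrier) → Carrier
    ⋀-lower   : ∀ {I : Set} (f : I → Carrier) (i : I) → ⋀ f ≼ f i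
    ⋀-greatest : ∀ {I : Set} (f : I → Carrier) (x : Carrier) →
                 (∀ i → x ≼ f i) → x ≼ ⋀ f
    _⊸_       : Carrier → Carrier → Carrier
    ⊸-mono    : ∀ {a a′ b b′} → a′ ≼ a → b ≼ b′ → (a ⊸ b) ≼ (a′ ⊸ b′)
    ⊸-⋀       : ∀ (a : Carrier) {I : Set} (f : I → Carrier) →
                a ⊸ ⋀ f ≡ ⋀ (λ i → a ⊸ f i)

module _ (𝒜 : ImplicativeStructure) where
  open ImplicativeStructure 𝒜

  _⊗_ : Carrier → Carrier → Carrier
  a ⊗ b = ⋀ (λ c → (a ⊸ b ⊸ c) ⊸ c)

  𝐈 : Carrier
  𝐈 = ⋀ (λ a → a ⊸ a)

  𝐁 : Carrier
  𝐁 = ⋀ (λ (t : Carrier × Carrier × Carrier) → let (a , b , c) = t in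
           (b ⊸ c) ⊸ (a ⊸ b) ⊸ a ⊸ c)

  𝐂 : Carrier
  𝐂 = ⋀ (λ (t : Carrier × Carrier × Carrier) → let (a , b , c) = t in
           (a ⊸ b ⊸ c) ⊸ b ⊸ a ⊸ c)

  record IsLinearSeparator (S : Carrier → Set) : Set where
    field
      upward : ∀ {a b} → a ≼ b → S a → S b
      mp     : ∀ {a b} → S a → S (a ⊸ b) → S b
      I∈S    : S 𝐈
      B∈S    : S 𝐁
      C∈S    : S 𝐂

  _⊢[_]_ : Carrier → (Carrier → Set) → Carrier → Set
  a ⊢[ S ] b = S (a ⊸ b)

  _⊣⊢[_]_ : Carrier → (Carrier → Set) → Carrier → Set
  a ⊣⊢[ S ] b = (a ⊢[ S ] b) × (b ⊢[ S ] a)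

-- Both halves reduce to three derived rules of entailment, each obtained from the
-- combinators 𝐁 and 𝐁′ = 𝐂 𝐁 by modus ponens: transitivity, post-composition
-- (b ⊢ b′ gives a ⊸ b ⊢ a ⊸ b′) and pre-composition (a′ ⊢ a gives a ⊸ c ⊢ a′ ⊸ c).
-- Since a ⊗ b is a meet over all c, the rules are proved uniformly for families,
-- with a single realiser ⋀ᵢ (f i ⊸ g i) ∈ S. The uniform entailment
-- (a′ ⊸ b′ ⊸ c) ⊢ (a ⊸ b ⊸ c) then gives a ⊗ b ⊢ a′ ⊗ b′, since h ↦ ⋀_c (h c ⊸ c)
-- is antitone.
module Submission where

open import Defs
open import Data.Product using (_×_; _,_)
open import Data.Unit using (⊤; tt)
open import Relation.Binary.PropositionalEquality using (subst; sym)

module LinearEntailment (𝒜 : ImplicativeStructure) (S : ImplicativeStructure.Carrier 𝒜 → Set)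
                        (isLinearSeparator : IsLinearSeparator 𝒜 S) where
  open ImplicativeStructure 𝒜
  open IsLinearSeparator isLinearSeparator

  infix 4 _⊢_ _⊢ᵤ_

  _⊢_ : Carrier → Carrier → Set
  a ⊢ b = S (a ⊸ b)

  _⊢ᵤ_ : {I : Set} → (I → Carrier) → (I → Carrier) → Set
  f ⊢ᵤ g = S (⋀ (λ i → f i ⊸ g i))

  ⊸-⋀-greatest : ∀ {I : Set} (f : I → Carrier) {x v} → (∀ i → x ≼ v ⊸ f i) → x ≼ v ⊸ ⋀ f
  ⊸-⋀-greatest f {x} {v} h = subst (x ≼_) (sym (⊸-⋀ v f)) (⋀-greatest _ x h)

  mp-⋀ : ∀ {I : Set} (f : I → Carrier) {u v} → S u → S v → (∀ i → u ≼ v ⊸ f i) → S (⋀ f)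
  mp-⋀ f su sv h = mp sv (upward (⊸-⋀-greatest f h) su)

  mp₂-⋀ : ∀ {I : Set} (f : I → Carrier) {u v w} →
          S u → S v → S w → (∀ i → u ≼ v ⊸ w ⊸ f i) → S (⋀ f)
  mp₂-⋀ f {w = w} su sv sw h = mp sw (subst S (sym (⊸-⋀ w f)) (mp-⋀ (λ i → w ⊸ f i) su sv h))

  𝐁′ : Carrier
  𝐁′ = ⋀ (λ (t : Carrier × Carrier × Carrier) → let (a , b , c) = t in
            (a ⊸ b) ⊸ (b ⊸ c) ⊸ a ⊸ c)

  𝐁′-lower : ∀ a b c → 𝐁′ ≼ (a ⊸ b) ⊸ (b ⊸ c) ⊸ a ⊸ c
  𝐁′-lower a b c = ⋀-lower _ (a , b , c)

  𝐁′∈S : S 𝐁′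
  𝐁′∈S = mp-⋀ _ C∈S B∈S λ { (a , b , c) →
    ≼-trans (⋀-lower _ (b ⊸ c , a ⊸ b , a ⊸ c))
            (⊸-mono (⋀-lower _ (a , b , c)) ≼-refl) }

  ⊢ᵤ-instance : ∀ {I : Set} {f g : I → Carrier} → f ⊢ᵤ g → ∀ i → f i ⊢ g i
  ⊢ᵤ-instance fg i = upward (⋀-lower _ i) fg

  ⊢⇒⊢ᵤ-const : ∀ {I : Set} {a b} → a ⊢ b → (λ (_ : I) → a) ⊢ᵤ (λ _ → b)
  ⊢⇒⊢ᵤ-const {a = a} {b} ab = upward (⋀-greatest _ (a ⊸ b) (λ _ → ≼-refl)) ab

  ⊢ᵤ-trans : ∀ {I : Set} {f g h : I → Carrier} → f ⊢ᵤ g → g ⊢ᵤ h → f ⊢ᵤ h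
  ⊢ᵤ-trans {f = f} {g} {h} fg gh = mp₂-⋀ _ 𝐁′∈S fg gh λ i →
    ≼-trans (𝐁′-lower (f i) (g i) (h i))
            (⊸-mono (⋀-lower _ i) (⊸-mono (⋀-lower _ i) ≼-refl))

  ⊸-postcomp-⊢ᵤ : ∀ {I : Set} {f g : I → Carrier} a →
                  f ⊢ᵤ g → (λ i → a ⊸ f i) ⊢ᵤ (λ i → a ⊸ g i)
  ⊸-postcomp-⊢ᵤ {f = f} {g} a fg = mp-⋀ _ B∈S fg λ i →
    ≼-trans (⋀-lower _ (a , f i , g i)) (⊸-mono (⋀-lower _ i) ≼-refl)

  ⊸-precomp-⊢ᵤ : ∀ {I : Set} (f : I → Carrier) {a a′} →
                 a′ ⊢ a → (λ i → a ⊸ f i) ⊢ᵤ (λ i → a′ ⊸ f i)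
  ⊸-precomp-⊢ᵤ f {a} {a′} a′a = mp-⋀ _ 𝐁′∈S a′a λ i → 𝐁′-lower a′ a (f i)

  ⋀⊸-antitone-⊢ : ∀ {f g : Carrier → Carrier} →
                  f ⊢ᵤ g → ⋀ (λ c → g c ⊸ c) ⊢ ⋀ (λ c → f c ⊸ c)
  ⋀⊸-antitone-⊢ {f} {g} fg = subst S (sym (⊸-⋀ _ _)) (mp-⋀ _ 𝐁′∈S fg λ c →
    ≼-trans (𝐁′-lower (f c) (g c) c) (⊸-mono (⋀-lower _ c) (⊸-mono (⋀-lower _ c) ≼-refl)))

  ⊸-mono-⊢ : ∀ {a a′ b b′} → a′ ⊢ a → b ⊢ b′ → a ⊸ b ⊢ a′ ⊸ b′
  ⊸-mono-⊢ {a} {a′} {b} {b′} a′a bb′ = ⊢ᵤ-instance lhs⊢rhs tt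
    where
    lhs⊢rhs : (λ (_ : ⊤) → a ⊸ b) ⊢ᵤ (λ _ → a′ ⊸ b′)
    lhs⊢rhs = ⊢ᵤ-trans (⊸-postcomp-⊢ᵤ a (⊢⇒⊢ᵤ-const bb′)) (⊸-precomp-⊢ᵤ (λ _ → b′) a′a)

  ⊗-mono-⊢ : ∀ {a a′ b b′} → a ⊢ a′ → b ⊢ b′ → _⊗_ 𝒜 a b ⊢ _⊗_ 𝒜 a′ b′
  ⊗-mono-⊢ {a} {a′} {b} {b′} aa′ bb′ = ⋀⊸-antitone-⊢ curried
    where
    curried : (λ c → a′ ⊸ b′ ⊸ c) ⊢ᵤ (λ c → a ⊸ b ⊸ c)
    curried = ⊢ᵤ-trans (⊸-postcomp-⊢ᵤ a′ (⊸-precomp-⊢ᵤ (λ c → c) bb′))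
                       (⊸-precomp-⊢ᵤ (λ c → b ⊸ c) aa′)

proposition3p9 : (𝒜 : ImplicativeStructure) (S : ImplicativeStructure.Carrier 𝒜 → Set) →
    IsLinearSeparator 𝒜 S →
    ∀ (a a′ b b′ : ImplicativeStructure.Carrier 𝒜) →
    _⊣⊢[_]_ 𝒜 a S a′ → _⊣⊢[_]_ 𝒜 b S b′ →
    _⊣⊢[_]_ 𝒜 (ImplicativeStructure._⊸_ 𝒜 a b) S (ImplicativeStructure._⊸_ 𝒜 a′ b′)
    × _⊣⊢[_]_ 𝒜 (_⊗_ 𝒜 a b) S (_⊗_ 𝒜 a′ b′)
proposition3p9 𝒜 S isLinearSeparator a a′ b b′ (aa′ , a′a) (bb′ , b′b) =
  (⊸-mono-⊢ a′a bb′ , ⊸-mono-⊢ aa′ b′b) , (⊗-mono-⊢ aa′ bb′ , ⊗-mono-⊢ a′a b′b)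
  where open LinearEntailment 𝒜 S isLinearSeparator
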